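{- Let $k\ge 2$, $n\ge1$, let $l_1,\ldots,l_k$ be positive integers and $L=l_1+\cdots+l_k$. Let $\pi=s_1s_2\cdots s_{nL}$ be a lattice path in $\mathbb{N}^k$ from $(0,\ldots,0)$ to $(nl_1,\ldots,nl_k)$ with each step $s_i\in\{e_1,\ldots,e_k\}$. Then $\pi$ is an $n$-configuration path for the $(l_1,\ldots,l_k)$-tennis ball problem if and only if, for every $t$ with $1\le t\le n$ and every $i$ with $1\le i\le k-1$, among the first $tL$ steps $s_1,\ldots,s_{tL}$ at most $t(l_1+\cdots+l_i)$ belong to $\{e_1,\ldots,e_i\}$.
   Context: $e_1,\ldots,e_k$ are the unit coordinate vectors of $\mathbb{R}^k$. The $(l_1,\ldots,l_k)$-tennis ball problem: there are balls numbered $1,2,\ldots$ and bins $\Gamma_1,\ldots,\Gamma_k$, initially empty. In turn $t$ ($t=1,2,\ldots$), balls $(t-1)L+1,\ldots,tL$ are put into $\Gamma_1$; then, successively for $j=2,\ldots,k$, exactly $l_j+\cdots+l_k$ of the balls currently in $\Gamma_{j-1}$ (chosen arbitrarily) are moved to $\Gamma_j$. An $n$-configuration is an ordered $k$-partition $(A_1,\ldots,A_k)$ of $[nL]$ such that, for some choice of moves, after $n$ turns $A_j$ is exactly the set of balls in $\Gamma_j$ for every $j$. The $n$-configuration path associated with an $n$-configuration $(A_1,\ldots,A_k)$ is the path $s_1\cdots s_{nL}$ from the origin to $(nl_1,\ldots,nl_k)$ with $s_i=e_j$ whenever $i\in A_j$; an $n$-configuration path is a path arising this way from some $n$-configuration.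 -}

module Defs where

open import Data.Nat using (ℕ; zero; suc; _+_; _*_; _∸_; _<?_)
open import Data.Fin using (Fin; toℕ)
import Data.Fin as F
open import Data.List using (List; []; _∷_; _++_; replicate; map; filter; length; take)
open import Data.Product using (Σ; _×_)
open import Relation.Binary.PropositionalEquality using (_≡_)

-- psum l i = l_1 + ... + l_i  (0-based: sum of l j over j : Fin k with toℕ j < i)
psum : ∀ {k} → (Fin k → ℕ) → ℕ → ℕ
psum {zero}  l i       = 0
psum {suc k} l zero    = 0
psum {suc k} l (suc i) = l F.zero + psum (λ j → l (F.suc j)) i

total : ∀ {k} → (Fin k → ℕ) → ℕ
total {k} l = psum l k

-- A state of the process: the bin (0-based index; bin j is Γ_{j+1}) of each
-- ball present, ball number b stored at position b-1 of the list.
data MoveRel (a b : ℕ) : ℕ → List ℕ → List ℕ → Set where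
  done : MoveRel a b 0 [] []
  stay : ∀ {c x xs ys} → MoveRel a b c xs ys → MoveRel a b c (x ∷ xs) (x ∷ ys)
  move : ∀ {c xs ys} → MoveRel a b c xs ys → MoveRel a b (suc c) (a ∷ xs) (b ∷ ys)

module _ {k : ℕ} (l : Fin k → ℕ) where

  Cascade : ℕ → ℕ → List ℕ → List ℕ → Set
  Cascade j zero    xs ys = xs ≡ ys
  Cascade j (suc r) xs ys =
    Σ (List ℕ) λ zs → MoveRel j (suc j) (total l ∸ psum l (suc j)) xs zs
                      × Cascade (suc j) r zs ys

  Turn : List ℕ → List ℕ → Set
  Turn xs ys = Cascade 0 (k ∸ 1) (xs ++ replicate (total l) 0) ys

  data Reach : ℕ → List ℕ → Set where
    start : Reach 0 []
    turn  : ∀ {t xs ys} → Reach t xs → Turn xs ys → Reach (suc t) ys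

  -- An n-configuration (A_1,...,A_k), encoded by the bin of each ball
  -- 1..nL, is a reachable state after n turns; its configuration path is
  -- s_i = e_{bin of ball i}.
  IsConfigPath : ℕ → List (Fin k) → Set
  IsConfigPath n π = Reach n (map toℕ π)

  countLow : ℕ → ℕ → List (Fin k) → ℕ
  countLow m i π = length (filter (λ s → toℕ s <? i) (take m π))

  countDir : Fin k → List (Fin k) → ℕ
  countDir j π = length (filter (λ s → s F.≟ j) π)

-- After t turns exactly t c_i balls lie in the bins i, i+1, ... (bins counted from 0), where
-- c_i = l_{i+1} + ... + l_k, and balls only ever move to higher bins.  So if π is reached after
-- n turns, the first t L balls were already placed after turn t and at least t c_i of them lie in
-- bins ≥ i: this is the stated bound, counted on the complementary directions.  Conversely, induct
-- on n and undo the last turn from the top bin down, sending the latest c_i balls of bin i back to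
-- bin i - 1.  The prefix bounds are exactly what makes this possible while keeping the bounds for
-- one turn less, and at the end the last L balls are all back in the first bin.
module Submission where

open import Defs
open import Data.Nat using (ℕ; zero; suc; _+_; _*_; _∸_; _≤_; _<_; _⊓_; z≤n; s≤s; s≤s⁻¹; _≟_; _≤?_; _<?_)
open import Data.Nat.Properties
open import Data.Fin using (Fin; toℕ; fromℕ<)
import Data.Fin as F
open import Data.Fin.Properties using (toℕ<n; toℕ-injective; toℕ-fromℕ<)
open import Data.List using (List; []; _∷_; _++_; replicate; map; filter; length; take; drop)
open import Data.List.Properties
  using (length-replicate; length-++; length-take; length-drop; length-map; take-all; take-take;
         take++drop≡id; take-map; filter-accept; filter-reject)
open import Data.List.Relation.Binary.Pointwise using (Pointwise; []; _∷_)
import Data.List.Relation.Binary.Pointwise as Pw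
open import Data.Product using (Σ; _×_; _,_)
open import Data.Sum using (inj₁; inj₂)
open import Function using (_∘_)
open import Function.Bundles using (_⇔_; mk⇔; Equivalence)
open import Relation.Nullary using (yes; no)
open import Relation.Nullary.Negation using (contradiction)
open import Relation.Binary.PropositionalEquality

≤⇔≥-complement : ∀ {a b c d} → a + b ≡ c + d → (a ≤ c ⇔ d ≤ b)
≤⇔≥-complement {a} {b} {c} {d} a+b≡c+d = mk⇔
  (λ a≤c → +-cancelˡ-≤ c d b (≤-trans (≤-reflexive (sym a+b≡c+d)) (+-monoˡ-≤ b a≤c)))
  (λ d≤b → +-cancelʳ-≤ b a c (≤-trans (≤-reflexive a+b≡c+d) (+-monoʳ-≤ c d≤b)))

length-take-≤ : ∀ {A : Set} {m} {xs : List A} → m ≤ length xs → length (take m xs) ≡ m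
length-take-≤ {m = m} {xs} m≤ = trans (length-take m xs) (m≤n⇒m⊓n≡m m≤)

count≥ : ℕ → List ℕ → ℕ
count≥ i []       = 0
count≥ i (x ∷ xs) with i ≤? x
... | yes _ = suc (count≥ i xs)
... | no  _ = count≥ i xs

count≡ : ℕ → List ℕ → ℕ
count≡ i []       = 0
count≡ i (x ∷ xs) with x ≟ i
... | yes _ = suc (count≡ i xs)
... | no  _ = count≡ i xs

count≥-zero : ∀ xs → count≥ 0 xs ≡ length xs
count≥-zero []       = refl
count≥-zero (x ∷ xs) = cong suc (count≥-zero xs)

count≥-split : ∀ i xs → count≥ i xs ≡ count≡ i xs + count≥ (suc i) xs
count≥-split i []       = refl
count≥-split i (x ∷ xs) with i ≤? x | x ≟ i | suc i ≤? x
... | yes _   | yes refl | yes i<i = contradiction i<i (n≮n i)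
... | yes _   | yes refl | no  _   = cong suc (count≥-split i xs)
... | yes i≤x | no  x≢i  | no  i≮x = contradiction (≤-antisym (≮⇒≥ i≮x) i≤x) x≢i
... | yes _   | no  _    | yes _   = trans (cong suc (count≥-split i xs)) (sym (+-suc _ _))
... | no  i≰x | yes refl | _       = contradiction ≤-refl i≰x
... | no  i≰x | no  _    | yes i<x = contradiction (<⇒≤ i<x) i≰x
... | no  _   | no  _    | no  _   = count≥-split i xs

count≥-++ : ∀ i xs ys → count≥ i (xs ++ ys) ≡ count≥ i xs + count≥ i ys
count≥-++ i []       ys = refl
count≥-++ i (x ∷ xs) ys with i ≤? x
... | yes _ = cong suc (count≥-++ i xs ys)
... | no  _ = count≥-++ i xs ys

count≥-suc-replicate-0 : ∀ i m → count≥ (suc i) (replicate m 0) ≡ 0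
count≥-suc-replicate-0 i zero    = refl
count≥-suc-replicate-0 i (suc m) = count≥-suc-replicate-0 i m

count≥1≡0⇒replicate : ∀ xs → count≥ 1 xs ≡ 0 → xs ≡ replicate (length xs) 0
count≥1≡0⇒replicate []           _    = refl
count≥1≡0⇒replicate (zero  ∷ xs) none = cong (0 ∷_) (count≥1≡0⇒replicate xs none)
count≥1≡0⇒replicate (suc _ ∷ xs) ()

count≥-∷-cong : ∀ i x {xs ys} → count≥ i xs ≡ count≥ i ys → count≥ i (x ∷ xs) ≡ count≥ i (x ∷ ys)
count≥-∷-cong i x eq with i ≤? x
... | yes _ = cong suc eq
... | no  _ = eq

count≥-∷-lower : ∀ {i} a {xs ys} → i ≢ suc a → count≥ i xs ≡ count≥ i ys →
                 count≥ i (a ∷ xs) ≡ count≥ i (suc a ∷ ys)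
count≥-∷-lower {i} a i≢1+a eq with i ≤? a | i ≤? suc a
... | yes _   | yes _     = cong suc eq
... | yes i≤a | no  i≰1+a = contradiction (m≤n⇒m≤1+n i≤a) i≰1+a
... | no  i≰a | yes i≤1+a = contradiction (≤-antisym i≤1+a (≰⇒> i≰a)) i≢1+a
... | no  _   | no  _     = eq

count≥-∷-shift : ∀ {a x xs ys m} → x ≢ suc a →
                 count≥ (suc a) ys ≡ count≥ (suc (suc a)) xs + m →
                 count≥ (suc a) (x ∷ ys) ≡ count≥ (suc (suc a)) (x ∷ xs) + m
count≥-∷-shift {a} {x} x≢1+a eq with suc a ≤? x | suc (suc a) ≤? x
... | yes _     | yes _     = cong suc eq
... | yes 1+a≤x | no  1+a≮x = contradiction (≤-antisym (≮⇒≥ 1+a≮x) 1+a≤x) x≢1+a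
... | no  1+a≰x | yes 1+a<x = contradiction (<⇒≤ 1+a<x) 1+a≰x
... | no  _     | no  _     = eq

count≥-take : ∀ i m xs → count≥ i (take m xs) ≤ count≥ i xs
count≥-take i zero    xs       = z≤n
count≥-take i (suc m) []       = z≤n
count≥-take i (suc m) (x ∷ xs) with i ≤? x
... | yes _ = s≤s (count≥-take i m xs)
... | no  _ = count≥-take i m xs

count≥-take-++ : ∀ i m xs ys → count≥ i (take m xs) ≤ count≥ i (take m (xs ++ ys))
count≥-take-++ i zero    xs       ys = z≤n
count≥-take-++ i (suc m) []       ys = z≤n
count≥-take-++ i (suc m) (x ∷ xs) ys with i ≤? x
... | yes _ = s≤s (count≥-take-++ i m xs ys)
... | no  _ = count≥-take-++ i m xs ys

count≥-take-pointwise : ∀ i m {xs ys} → Pointwise _≤_ xs ys →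
                        count≥ i (take m xs) ≤ count≥ i (take m ys)
count≥-take-pointwise i zero    _  = z≤n
count≥-take-pointwise i (suc m) [] = z≤n
count≥-take-pointwise i (suc m) {x ∷ _} {y ∷ _} (x≤y ∷ xs≤ys) with i ≤? x | i ≤? y
... | yes _   | yes _   = s≤s (count≥-take-pointwise i m xs≤ys)
... | yes i≤x | no  i≰y = contradiction (≤-trans i≤x x≤y) i≰y
... | no  _   | yes _   = m≤n⇒m≤1+n (count≥-take-pointwise i m xs≤ys)
... | no  _   | no  _   = count≥-take-pointwise i m xs≤ys

count≥-beyond : ∀ {k} i (π : List (Fin k)) → k ≤ i → count≥ i (map toℕ π) ≡ 0
count≥-beyond i []      _   = refl
count≥-beyond i (x ∷ π) k≤i with i ≤? toℕ x
... | yes i≤x = contradiction (≤-trans k≤i i≤x) (<⇒≱ (toℕ<n x))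
... | no  _   = count≥-beyond i π k≤i

count<+count≥ : ∀ {k} i (π : List (Fin k)) →
                length (filter (λ s → toℕ s <? i) π) + count≥ i (map toℕ π) ≡ length π
count<+count≥ i []      = refl
count<+count≥ i (x ∷ π) with toℕ x <? i | i ≤? toℕ x
... | yes x<i | yes i≤x = contradiction i≤x (<⇒≱ x<i)
... | yes x<i | no  _   =
  trans (cong (λ ys → length ys + _) (filter-accept (λ s → toℕ s <? i) x<i))
        (cong suc (count<+count≥ i π))
... | no  x≮i | yes _   =
  trans (cong (λ ys → length ys + _) (filter-reject (λ s → toℕ s <? i) x≮i))
        (trans (+-suc _ _) (cong suc (count<+count≥ i π)))
... | no  x≮i | no  i≰x = contradiction (≰⇒> i≰x) x≮i

count≡-map-toℕ : ∀ {k} (j : Fin k) (π : List (Fin k)) →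
                 count≡ (toℕ j) (map toℕ π) ≡ length (filter (λ s → s F.≟ j) π)
count≡-map-toℕ j []      = refl
count≡-map-toℕ j (x ∷ π) with x F.≟ j | toℕ x ≟ toℕ j
... | yes _   | yes _   = cong suc (count≡-map-toℕ j π)
... | yes x≡j | no  x≢j = contradiction (cong toℕ x≡j) x≢j
... | no  x≢j | yes x≡j = contradiction (toℕ-injective x≡j) x≢j
... | no  _   | no  _   = count≡-map-toℕ j π

psum-zero : ∀ {k} (l : Fin k → ℕ) → psum l 0 ≡ 0
psum-zero {zero}  l = refl
psum-zero {suc k} l = refl

psum-suc : ∀ {k} (l : Fin k → ℕ) {i} (i<k : i < k) → psum l (suc i) ≡ psum l i + l (fromℕ< i<k)
psum-suc {suc k} l {zero}  _         =
  trans (cong (l F.zero +_) (psum-zero (l ∘ F.suc))) (+-identityʳ _)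
psum-suc {suc k} l {suc i} (s≤s i<k) =
  trans (cong (l F.zero +_) (psum-suc (l ∘ F.suc) i<k)) (sym (+-assoc (l F.zero) _ _))

psum-≤-suc : ∀ {k} (l : Fin k → ℕ) i → psum l i ≤ psum l (suc i)
psum-≤-suc {zero}  l i       = z≤n
psum-≤-suc {suc k} l zero    = z≤n
psum-≤-suc {suc k} l (suc i) = +-monoʳ-≤ (l F.zero) (psum-≤-suc (l ∘ F.suc) i)

psum-≤-total : ∀ {k} (l : Fin k → ℕ) i → psum l i ≤ total l
psum-≤-total {zero}  l i       = z≤n
psum-≤-total {suc k} l zero    = z≤n
psum-≤-total {suc k} l (suc i) = +-monoʳ-≤ (l F.zero) (psum-≤-total (l ∘ F.suc) i)

psum-beyond : ∀ {k} (l : Fin k → ℕ) i → k ≤ i → psum l i ≡ total l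
psum-beyond {zero}  l i       _         = refl
psum-beyond {suc k} l (suc i) (s≤s k≤i) = cong (l F.zero +_) (psum-beyond (l ∘ F.suc) i k≤i)

-- c_i = l_{i+1} + ... + l_k in the paper's 1-based indexing: the number of balls entering
-- bin i (0-based) in each turn.
inflow : ∀ {k} → (Fin k → ℕ) → ℕ → ℕ
inflow l i = total l ∸ psum l i

inflow-zero : ∀ {k} (l : Fin k → ℕ) → inflow l 0 ≡ total l
inflow-zero l = cong (total l ∸_) (psum-zero l)

inflow-beyond : ∀ {k} (l : Fin k → ℕ) i → k ≤ i → inflow l i ≡ 0
inflow-beyond l i k≤i = trans (cong (total l ∸_) (psum-beyond l i k≤i)) (n∸n≡0 (total l))

*-inflow-beyond : ∀ {k} (l : Fin k → ℕ) t {i} → k ≤ i → t * inflow l i ≡ 0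
*-inflow-beyond l t {i} k≤i = trans (cong (t *_) (inflow-beyond l i k≤i)) (*-zeroʳ t)

inflow-suc-≤ : ∀ {k} (l : Fin k → ℕ) i → inflow l (suc i) ≤ inflow l i
inflow-suc-≤ l i = ∸-monoʳ-≤ (total l) (psum-≤-suc l i)

psum+inflow : ∀ {k} (l : Fin k → ℕ) i → psum l i + inflow l i ≡ total l
psum+inflow l i = m+[n∸m]≡n (psum-≤-total l i)

inflow-step : ∀ {k} (l : Fin k → ℕ) {i} (i<k : i < k) → inflow l i ≡ l (fromℕ< i<k) + inflow l (suc i)
inflow-step l {i} i<k = +-cancelˡ-≡ (psum l i) _ _ (begin
  psum l i + inflow l i                          ≡⟨ psum+inflow l i ⟩
  total l                                        ≡⟨ sym (psum+inflow l (suc i)) ⟩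
  psum l (suc i) + inflow l (suc i)              ≡⟨ cong (_+ inflow l (suc i)) (psum-suc l i<k) ⟩
  psum l i + l (fromℕ< i<k) + inflow l (suc i)   ≡⟨ +-assoc (psum l i) (l (fromℕ< i<k)) _ ⟩
  psum l i + (l (fromℕ< i<k) + inflow l (suc i)) ∎)
  where open ≡-Reasoning

move-pointwise : ∀ {a c xs ys} → MoveRel a (suc a) c xs ys → Pointwise _≤_ xs ys
move-pointwise done     = []
move-pointwise (stay m) = ≤-refl ∷ move-pointwise m
move-pointwise (move m) = n≤1+n _ ∷ move-pointwise m

move-count≥-other : ∀ {a c xs ys} i → MoveRel a (suc a) c xs ys → i ≢ suc a →
                    count≥ i ys ≡ count≥ i xs
move-count≥-other     i done             _     = refl
move-count≥-other     i (stay {x = x} m) i≢1+a = count≥-∷-cong i x (move-count≥-other i m i≢1+a)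
move-count≥-other {a} i (move m)         i≢1+a =
  sym (count≥-∷-lower a i≢1+a (sym (move-count≥-other i m i≢1+a)))

move-count≥ : ∀ {a c xs ys} → MoveRel a (suc a) c xs ys → count≥ (suc a) ys ≡ c + count≥ (suc a) xs
move-count≥ done = refl
move-count≥ {a} (stay {x = x} m) with suc a ≤? x
... | yes _ = trans (cong suc (move-count≥ m)) (sym (+-suc _ _))
... | no  _ = move-count≥ m
move-count≥ {a} (move m) with suc a ≤? suc a | suc a ≤? a
... | yes _   | yes a<a = contradiction a<a (n≮n a)
... | yes _   | no  _   = cong suc (move-count≥ m)
... | no  a≰a | _       = contradiction ≤-refl a≰a

-- Keeps the first s entries equal to suc a and replaces the later ones by a, i.e. takes the
-- latest balls of bin suc a back to bin a.
lower : ℕ → ℕ → List ℕ → List ℕ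
lower a s       []       = []
lower a zero    (x ∷ xs) with x ≟ suc a
... | yes _ = a ∷ lower a zero xs
... | no  _ = x ∷ lower a zero xs
lower a (suc s) (x ∷ xs) with x ≟ suc a
... | yes _ = x ∷ lower a s xs
... | no  _ = x ∷ lower a (suc s) xs

lower-take : ∀ a s m xs → take m (lower a s xs) ≡ lower a s (take m xs)
lower-take a s       zero    xs       = refl
lower-take a s       (suc m) []       = refl
lower-take a zero    (suc m) (x ∷ xs) with x ≟ suc a
... | yes _ = cong (a ∷_) (lower-take a zero m xs)
... | no  _ = cong (x ∷_) (lower-take a zero m xs)
lower-take a (suc s) (suc m) (x ∷ xs) with x ≟ suc a
... | yes _ = cong (x ∷_) (lower-take a s m xs)
... | no  _ = cong (x ∷_) (lower-take a (suc s) m xs)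

lower-count≥-other : ∀ a s i xs → i ≢ suc a → count≥ i (lower a s xs) ≡ count≥ i xs
lower-count≥-other a s       i []       _     = refl
lower-count≥-other a zero    i (x ∷ xs) i≢1+a with x ≟ suc a
... | yes refl = count≥-∷-lower a i≢1+a (lower-count≥-other a zero i xs i≢1+a)
... | no  _    = count≥-∷-cong i x (lower-count≥-other a zero i xs i≢1+a)
lower-count≥-other a (suc s) i (x ∷ xs) i≢1+a with x ≟ suc a
... | yes _ = count≥-∷-cong i x (lower-count≥-other a s i xs i≢1+a)
... | no  _ = count≥-∷-cong i x (lower-count≥-other a (suc s) i xs i≢1+a)

lower-count≥-+ : ∀ a s xs →
                 count≥ (suc a) (lower a s xs) ≡ count≥ (suc (suc a)) xs + s ⊓ count≡ (suc a) xs
lower-count≥-+ a zero    []       = refl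
lower-count≥-+ a (suc s) []       = refl
lower-count≥-+ a zero    (x ∷ xs) with x ≟ suc a
... | no  x≢1+a = count≥-∷-shift x≢1+a (lower-count≥-+ a zero xs)
... | yes refl with suc a ≤? a | suc (suc a) ≤? suc a
...   | yes a<a | _           = contradiction a<a (n≮n a)
...   | no  _   | yes 1+a<1+a = contradiction 1+a<1+a (n≮n (suc a))
...   | no  _   | no  _       = lower-count≥-+ a zero xs
lower-count≥-+ a (suc s) (x ∷ xs) with x ≟ suc a
... | no  x≢1+a = count≥-∷-shift x≢1+a (lower-count≥-+ a (suc s) xs)
... | yes refl with suc a ≤? suc a | suc (suc a) ≤? suc a
...   | no  a≰a | _           = contradiction ≤-refl a≰a
...   | yes _   | yes 1+a<1+a = contradiction 1+a<1+a (n≮n (suc a))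
...   | yes _   | no  _       = trans (cong suc (lower-count≥-+ a s xs)) (sym (+-suc _ _))

lower-count≥ : ∀ a s xs →
               count≥ (suc a) (lower a s xs) ≡ (count≥ (suc (suc a)) xs + s) ⊓ count≥ (suc a) xs
lower-count≥ a s xs = begin
  count≥ (suc a) (lower a s xs)               ≡⟨ lower-count≥-+ a s xs ⟩
  above + s ⊓ count≡ (suc a) xs               ≡⟨ +-distribˡ-⊓ above s _ ⟩
  (above + s) ⊓ (above + count≡ (suc a) xs)   ≡⟨ cong ((above + s) ⊓_) (+-comm above _) ⟩
  (above + s) ⊓ (count≡ (suc a) xs + above)   ≡⟨ cong ((above + s) ⊓_) (sym (count≥-split (suc a) xs)) ⟩
  (above + s) ⊓ count≥ (suc a) xs             ∎
  where
  open ≡-Reasoning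
  above = count≥ (suc (suc a)) xs

lower-move : ∀ a s xs → s ≤ count≡ (suc a) xs →
             MoveRel a (suc a) (count≡ (suc a) xs ∸ s) (lower a s xs) xs
lower-move a zero    []       _   = done
lower-move a zero    (x ∷ xs) _   with x ≟ suc a
... | yes refl = move (lower-move a zero xs z≤n)
... | no  _    = stay (lower-move a zero xs z≤n)
lower-move a (suc s) (x ∷ xs) s<c with x ≟ suc a
... | yes refl = stay (lower-move a s xs (s≤s⁻¹ s<c))
... | no  _    = stay (lower-move a (suc s) xs s<c)

module _ {k : ℕ} (l : Fin k → ℕ) where

  private
    L : ℕ
    L = total l

  cascade-pointwise : ∀ {j r xs ys} → Cascade l j r xs ys → Pointwise _≤_ xs ys
  cascade-pointwise {r = zero}  refl           = Pw.refl ≤-refl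
  cascade-pointwise {r = suc r} (_ , m , rest) =
    Pw.transitive ≤-trans (move-pointwise m) (cascade-pointwise rest)

  cascade-count≥-below : ∀ {j r xs ys} i → Cascade l j r xs ys → i ≤ j → count≥ i ys ≡ count≥ i xs
  cascade-count≥-below {r = zero}  i refl           _   = refl
  cascade-count≥-below {r = suc r} i (_ , m , rest) i≤j =
    trans (cascade-count≥-below i rest (m≤n⇒m≤1+n i≤j)) (move-count≥-other i m (<⇒≢ (s≤s i≤j)))

  cascade-count≥ : ∀ {j r xs ys} i → Cascade l j r xs ys → j < i → i ≤ j + r →
                   count≥ i ys ≡ inflow l i + count≥ i xs
  cascade-count≥ {j} {zero}  i refl j<i i≤j+0 =
    contradiction (≤-trans i≤j+0 (≤-reflexive (+-identityʳ j))) (<⇒≱ j<i)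
  cascade-count≥ {j} {suc r} i (_ , m , rest) j<i i≤j+1+r with i ≟ suc j
  ... | yes refl  = trans (cascade-count≥-below i rest ≤-refl) (move-count≥ m)
  ... | no  i≢1+j =
    trans (cascade-count≥ i rest (≤∧≢⇒< j<i (i≢1+j ∘ sym)) (≤-trans i≤j+1+r (≤-reflexive (+-suc j r))))
          (cong (inflow l i +_) (move-count≥-other i m i≢1+j))

  turn-pointwise : ∀ {xs ys} → Turn l xs ys → Pointwise _≤_ (xs ++ replicate L 0) ys
  turn-pointwise = cascade-pointwise

  turn-count≥ : ∀ {xs ys} i → Turn l xs ys → i < k → count≥ i ys ≡ inflow l i + count≥ i xs
  turn-count≥ {xs} {ys} zero T _ = begin
    count≥ 0 ys                             ≡⟨ cascade-count≥-below 0 T z≤n ⟩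
    count≥ 0 (xs ++ replicate L 0)          ≡⟨ count≥-++ 0 xs _ ⟩
    count≥ 0 xs + count≥ 0 (replicate L 0)  ≡⟨ cong (count≥ 0 xs +_) (count≥-zero (replicate L 0)) ⟩
    count≥ 0 xs + length (replicate L 0)    ≡⟨ cong (count≥ 0 xs +_) (length-replicate L) ⟩
    count≥ 0 xs + L                         ≡⟨ +-comm _ L ⟩
    L + count≥ 0 xs                         ≡⟨ cong (_+ count≥ 0 xs) (sym (inflow-zero l)) ⟩
    inflow l 0 + count≥ 0 xs                ∎
    where open ≡-Reasoning
  turn-count≥ {xs} {ys} (suc i) T i<k = begin
    count≥ (suc i) ys                        ≡⟨ cascade-count≥ (suc i) T (s≤s z≤n) (<⇒≤pred i<k) ⟩
    c + count≥ (suc i) (xs ++ replicate L 0) ≡⟨ cong (c +_) (count≥-++ (suc i) xs _) ⟩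
    c + (count≥ (suc i) xs + count≥ (suc i) (replicate L 0))
      ≡⟨ cong (λ z → c + (count≥ (suc i) xs + z)) (count≥-suc-replicate-0 i L) ⟩
    c + (count≥ (suc i) xs + 0)              ≡⟨ cong (c +_) (+-identityʳ _) ⟩
    c + count≥ (suc i) xs                    ∎
    where
    open ≡-Reasoning
    c = inflow l (suc i)

  reach-length : ∀ {n ys} → Reach l n ys → length ys ≡ n * L
  reach-length start = refl
  reach-length {suc n} {ys} (turn {xs = xs} r T) = begin
    length ys                          ≡⟨ sym (Pw.Pointwise-length (turn-pointwise T)) ⟩
    length (xs ++ replicate L 0)       ≡⟨ length-++ xs ⟩
    length xs + length (replicate L 0) ≡⟨ cong₂ _+_ (reach-length r) (length-replicate L) ⟩
    n * L + L                          ≡⟨ +-comm (n * L) L ⟩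
    suc n * L                          ∎
    where open ≡-Reasoning

  -- For 1 ≤ i < k, prefix≥ is the paper's bound on the first t L steps, counted on the
  -- complementary directions e_{i+1}, ..., e_k.
  record Profile (n i : ℕ) (ys : List ℕ) : Set where
    field
      total≡  : count≥ i ys ≡ n * inflow l i
      prefix≥ : ∀ {t} → t ≤ n → t * inflow l i ≤ count≥ i (take (t * L) ys)
  open Profile

  reach⇒profile : ∀ {n ys} → Reach l n ys → ∀ i → i < k → Profile n i ys
  reach⇒profile start i _ = record { total≡ = refl ; prefix≥ = λ { z≤n → z≤n } }
  reach⇒profile {suc n} {ys} (turn {xs = xs} r T) i i<k =
    record { total≡ = total≡′ ; prefix≥ = prefix≥′ }
    where
    P = reach⇒profile r i i<k
    total≡′ : count≥ i ys ≡ suc n * inflow l i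
    total≡′ = trans (turn-count≥ i T i<k) (cong (inflow l i +_) (total≡ P))
    prefix≥′ : ∀ {t} → t ≤ suc n → t * inflow l i ≤ count≥ i (take (t * L) ys)
    prefix≥′ {t} t≤1+n with m≤n⇒m<n∨m≡n t≤1+n
    ... | inj₁ (s≤s t≤n) = begin
      t * inflow l i                                 ≤⟨ prefix≥ P t≤n ⟩
      count≥ i (take (t * L) xs)                     ≤⟨ count≥-take-++ i (t * L) xs _ ⟩
      count≥ i (take (t * L) (xs ++ replicate L 0))  ≤⟨ count≥-take-pointwise i (t * L) (turn-pointwise T) ⟩
      count≥ i (take (t * L) ys)                     ∎
      where open ≤-Reasoning
    ... | inj₂ refl = ≤-reflexive (begin
      suc n * inflow l i              ≡⟨ sym total≡′ ⟩
      count≥ i ys                     ≡⟨ cong (count≥ i) (sym (take-all _ ys (≤-reflexive (reach-length (turn r T))))) ⟩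
      count≥ i (take (suc n * L) ys)  ∎)
      where open ≡-Reasoning

  profile-count≥-take : ∀ {n i W} → Profile n i W → count≥ i (take (n * L) W) ≡ n * inflow l i
  profile-count≥-take {n} {i} {W} P =
    ≤-antisym (≤-trans (count≥-take i (n * L) W) (≤-reflexive (total≡ P))) (prefix≥ P ≤-refl)

  profile-take : ∀ {m n i W} → n ≤ m → Profile m i W → count≥ i (take (n * L) W) ≡ n * inflow l i →
                 Profile n i (take (n * L) W)
  profile-take {m} {n} {i} {W} n≤m P exact = record
    { total≡  = exact
    ; prefix≥ = λ {t} t≤n → subst (λ V → t * inflow l i ≤ count≥ i V)
                                  (sym (take-of-take t≤n)) (prefix≥ P (≤-trans t≤n n≤m)) }
    where
    take-of-take : ∀ {t} → t ≤ n → take (t * L) (take (n * L) W) ≡ take (t * L) W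
    take-of-take {t} t≤n =
      trans (take-take (t * L) (n * L) W) (cong (λ p → take p W) (m≤n⇒m⊓n≡m (*-monoˡ-≤ L t≤n)))

  profile-beyond : ∀ {n i ys} → k ≤ i → count≥ i ys ≡ 0 → Profile n i ys
  profile-beyond {n} {i} {ys} k≤i none = record
    { total≡  = trans none (sym (*-inflow-beyond l n k≤i))
    ; prefix≥ = λ {t} _ → subst (_≤ count≥ i (take (t * L) ys)) (sym (*-inflow-beyond l t k≤i)) z≤n }

  profile-lower-other : ∀ {m i a s W} → i ≢ suc a → Profile m i W → Profile m i (lower a s W)
  profile-lower-other {m} {i} {a} {s} {W} i≢1+a P = record
    { total≡  = trans (lower-count≥-other a s i W i≢1+a) (total≡ P)
    ; prefix≥ = λ {t} t≤m → subst (t * inflow l i ≤_) (sym (unchanged (t * L))) (prefix≥ P t≤m) }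
    where
    unchanged : ∀ p → count≥ i (take p (lower a s W)) ≡ count≥ i (take p W)
    unchanged p = trans (cong (count≥ i) (lower-take a s p W)) (lower-count≥-other a s i (take p W) i≢1+a)

  -- The balls that enter bin b in a turn and stay there: l_{b+1} in the paper's indexing, for b < k.
  netInflow : ℕ → ℕ
  netInflow b = inflow l b ∸ inflow l (suc b)

  *-inflow-split : ∀ t b → t * inflow l b ≡ t * inflow l (suc b) + t * netInflow b
  *-inflow-split t b =
    trans (cong (t *_) (sym (m+[n∸m]≡n (inflow-suc-≤ l b)))) (*-distribˡ-+ t _ _)

  count≡-stage : ∀ {n b W} → Profile (suc n) b W → Profile n (suc b) W →
                 count≡ b W ≡ inflow l b + n * netInflow b
  count≡-stage {n} {b} {W} P₁ P₀ = +-cancelʳ-≡ (n * c′) _ _ (begin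
    count≡ b W + n * c′                  ≡⟨ cong (count≡ b W +_) (sym (total≡ P₀)) ⟩
    count≡ b W + count≥ (suc b) W        ≡⟨ sym (count≥-split b W) ⟩
    count≥ b W                           ≡⟨ total≡ P₁ ⟩
    c + n * c                            ≡⟨ cong (c +_) (*-inflow-split n b) ⟩
    c + (n * c′ + n * netInflow b)       ≡⟨ cong (c +_) (+-comm (n * c′) _) ⟩
    c + (n * netInflow b + n * c′)       ≡⟨ sym (+-assoc c _ _) ⟩
    c + n * netInflow b + n * c′         ∎)
    where
    open ≡-Reasoning
    c  = inflow l b
    c′ = inflow l (suc b)

  profile-lower : ∀ {n a W} → Profile (suc n) (suc a) W → Profile n (suc (suc a)) W →
                  Profile n (suc a) (lower a (n * netInflow (suc a)) W)
  profile-lower {n} {a} {W} P₁ P₀ = record { total≡ = exact ; prefix≥ = prefix }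
    where
    open ≤-Reasoning
    b = suc a
    s = n * netInflow b
    c  = inflow l b
    c′ = inflow l (suc b)
    exact : count≥ b (lower a s W) ≡ n * inflow l b
    exact = begin-equality
      count≥ b (lower a s W)               ≡⟨ lower-count≥ a s W ⟩
      (count≥ (suc b) W + s) ⊓ count≥ b W  ≡⟨ cong₂ (λ u v → (u + s) ⊓ v) (total≡ P₀) (total≡ P₁) ⟩
      (n * c′ + s) ⊓ (suc n * c)           ≡⟨ cong (_⊓ (suc n * c)) (sym (*-inflow-split n b)) ⟩
      (n * c) ⊓ (suc n * c)                ≡⟨ m≤n⇒m⊓n≡m (*-monoˡ-≤ c (n≤1+n n)) ⟩
      n * c                                ∎
    prefix : ∀ {t} → t ≤ n → t * inflow l b ≤ count≥ b (take (t * L) (lower a s W))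
    prefix {t} t≤n = begin
      t * inflow l b                         ≤⟨ ⊓-glb above (prefix≥ P₁ (m≤n⇒m≤1+n t≤n)) ⟩
      (count≥ (suc b) V + s) ⊓ count≥ b V    ≡⟨ sym (lower-count≥ a s V) ⟩
      count≥ b (lower a s V)                 ≡⟨ cong (count≥ b) (sym (lower-take a s (t * L) W)) ⟩
      count≥ b (take (t * L) (lower a s W))  ∎
      where
      V = take (t * L) W
      above : t * inflow l b ≤ count≥ (suc b) V + s
      above = begin
        t * inflow l b                          ≡⟨ *-inflow-split t b ⟩
        t * inflow l (suc b) + t * netInflow b  ≤⟨ +-mono-≤ (prefix≥ P₀ t≤n) (*-monoˡ-≤ (netInflow b) t≤n) ⟩
        count≥ (suc b) V + s                    ∎

  -- A state during turn n + 1, after the moves into bins 1, ..., j.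
  record Midturn (n j : ℕ) (W : List ℕ) : Set where
    field
      crossed : ∀ {i} → i ≤ j → Profile (suc n) i W
      pending : ∀ {i} → j < i → Profile n i W
  open Midturn

  undo-move : ∀ {n a W} → Midturn n (suc a) W →
              let V = lower a (n * netInflow (suc a)) W in
              Midturn n a V × MoveRel a (suc a) (inflow l (suc a)) V W
  undo-move {n} {a} {W} M = record { crossed = crossed′ ; pending = pending′ } , moved
    where
    s = n * netInflow (suc a)
    P₁ = crossed M ≤-refl
    P₀ = pending M ≤-refl
    crossed′ : ∀ {i} → i ≤ a → Profile (suc n) i (lower a s W)
    crossed′ i≤a = profile-lower-other (<⇒≢ (s≤s i≤a)) (crossed M (m≤n⇒m≤1+n i≤a))
    pending′ : ∀ {i} → a < i → Profile n i (lower a s W)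
    pending′ {i} a<i with i ≟ suc a
    ... | yes refl  = profile-lower P₁ P₀
    ... | no  i≢1+a = profile-lower-other i≢1+a (pending M (≤∧≢⇒< a<i (i≢1+a ∘ sym)))
    moved : MoveRel a (suc a) (inflow l (suc a)) (lower a s W) W
    moved = subst (λ c → MoveRel a (suc a) c (lower a s W) W)
                  (trans (cong (_∸ s) (count≡-stage P₁ P₀)) (m+n∸n≡m _ s))
                  (lower-move a s W (≤-trans (m≤n+m s _) (≤-reflexive (sym (count≡-stage P₁ P₀)))))

  undo-cascade : ∀ {n ys} r j → Midturn n (j + r) ys →
                 Σ (List ℕ) λ W → Cascade l j r W ys × Midturn n j W
  undo-cascade {n} {ys} zero    j M = ys , refl , subst (λ m → Midturn n m ys) (+-identityʳ j) M
  undo-cascade {n} {ys} (suc r) j M =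
    let W , cascade , M′ = undo-cascade r (suc j) (subst (λ m → Midturn n m ys) (+-suc j r) M)
        M″ , moved = undo-move M′
    in  _ , (W , moved , cascade) , M″

  profile⇒midturn : ∀ {n ys} → (∀ i → Profile (suc n) i ys) → Midturn n (k ∸ 1) ys
  profile⇒midturn {n} P = record { crossed = λ _ → P _ ; pending = pending′ }
    where
    pending′ : ∀ {i} → k ∸ 1 < i → Profile n i _
    pending′ {i} k∸1<i = profile-beyond k≤i (trans (total≡ (P i)) (*-inflow-beyond l (suc n) k≤i))
      where k≤i = ≤-trans (m≤n+m∸n k 1) k∸1<i

  midturn-zero⇒padded : ∀ {n W} → Midturn n 0 W →
                        W ≡ take (n * L) W ++ replicate L 0 × (∀ i → Profile n i (take (n * L) W))
  midturn-zero⇒padded {n} {W} M = W≡ , profile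
    where
    open ≡-Reasoning
    length-W : length W ≡ suc n * L
    length-W = trans (sym (count≥-zero W)) (trans (total≡ (crossed M z≤n)) (cong (suc n *_) (inflow-zero l)))
    P₁ = pending M (s≤s z≤n)
    profile : ∀ i → Profile n i (take (n * L) W)
    profile zero = profile-take (n≤1+n n) (crossed M z≤n) (begin
      count≥ 0 (take (n * L) W)  ≡⟨ count≥-zero (take (n * L) W) ⟩
      length (take (n * L) W)    ≡⟨ length-take-≤ (≤-trans (m≤n+m (n * L) L) (≤-reflexive (sym length-W))) ⟩
      n * L                      ≡⟨ cong (n *_) (sym (inflow-zero l)) ⟩
      n * inflow l 0             ∎)
    profile (suc i) = profile-take ≤-refl P (profile-count≥-take P)
      where P = pending M (s≤s z≤n)
    front = take (n * L) W
    rest  = drop (n * L) W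
    rest-zero : count≥ 1 rest ≡ 0
    rest-zero = +-cancelˡ-≡ (count≥ 1 front) _ 0 (begin
      count≥ 1 front + count≥ 1 rest  ≡⟨ sym (count≥-++ 1 front rest) ⟩
      count≥ 1 (front ++ rest)        ≡⟨ cong (count≥ 1) (take++drop≡id (n * L) W) ⟩
      count≥ 1 W                      ≡⟨ total≡ P₁ ⟩
      n * inflow l 1                  ≡⟨ sym (profile-count≥-take P₁) ⟩
      count≥ 1 front                  ≡⟨ sym (+-identityʳ _) ⟩
      count≥ 1 front + 0              ∎)
    length-rest : length rest ≡ L
    length-rest = trans (length-drop (n * L) W) (trans (cong (_∸ n * L) length-W) (m+n∸n≡m L (n * L)))
    W≡ : W ≡ front ++ replicate L 0
    W≡ = begin
      W                               ≡⟨ sym (take++drop≡id (n * L) W) ⟩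
      front ++ rest                   ≡⟨ cong (front ++_) (count≥1≡0⇒replicate rest rest-zero) ⟩
      front ++ replicate (length rest) 0 ≡⟨ cong (λ m → front ++ replicate m 0) length-rest ⟩
      front ++ replicate L 0          ∎

  profile⇒reach : ∀ n ys → (∀ i → Profile n i ys) → Reach l n ys
  profile⇒reach zero    []       _ = start
  profile⇒reach zero    (y ∷ ys) P = contradiction (total≡ (P 0)) λ ()
  profile⇒reach (suc n) ys       P =
    let W , cascade , M = undo-cascade (k ∸ 1) 0 (profile⇒midturn P)
        W≡ , profile = midturn-zero⇒padded M
    in  turn (profile⇒reach n _ profile) (subst (λ V → Cascade l 0 (k ∸ 1) V ys) W≡ cascade)

  count≥-descend : ∀ {n i} π (i<k : i < k) → countDir l (fromℕ< i<k) π ≡ n * l (fromℕ< i<k) →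
                   count≥ (suc i) (map toℕ π) ≡ n * inflow l (suc i) →
                   count≥ i (map toℕ π) ≡ n * inflow l i
  count≥-descend {n} {i} π i<k dir above = begin
    count≥ i ys                      ≡⟨ count≥-split i ys ⟩
    count≡ i ys + count≥ (suc i) ys  ≡⟨ cong₂ _+_ at-i above ⟩
    n * l j + n * inflow l (suc i)   ≡⟨ sym (*-distribˡ-+ n (l j) _) ⟩
    n * (l j + inflow l (suc i))     ≡⟨ cong (n *_) (sym (inflow-step l i<k)) ⟩
    n * inflow l i                   ∎
    where
    open ≡-Reasoning
    ys = map toℕ π
    j = fromℕ< i<k
    at-i : count≡ i ys ≡ n * l j
    at-i = trans (cong (λ m → count≡ m ys) (sym (toℕ-fromℕ< i<k))) (trans (count≡-map-toℕ j π) dir)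

  count≥-balanced : ∀ {n} π → (∀ j → countDir l j π ≡ n * l j) →
                    ∀ i → count≥ i (map toℕ π) ≡ n * inflow l i
  count≥-balanced {n} π dirs i = from-top k i (m≤m+n k i)
    where
    from-top : ∀ d i → k ≤ d + i → count≥ i (map toℕ π) ≡ n * inflow l i
    from-top d i k≤d+i with k ≤? i
    ... | yes k≤i = trans (count≥-beyond i π k≤i) (sym (*-inflow-beyond l n k≤i))
    from-top zero    i k≤i   | no k≰i = contradiction k≤i k≰i
    from-top (suc d) i k≤d+i | no k≰i = count≥-descend {n} π (≰⇒> k≰i) (dirs _)
      (from-top d (suc i) (≤-trans k≤d+i (≤-reflexive (sym (+-suc d i)))))

  countLow⇔prefix : ∀ {n} π → length π ≡ n * L → ∀ {t} i → t ≤ n →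
                    countLow l (t * L) i π ≤ t * psum l i ⇔
                    t * inflow l i ≤ count≥ i (take (t * L) (map toℕ π))
  countLow⇔prefix {n} π length-π {t} i t≤n = ≤⇔≥-complement (begin
    countLow l (t * L) i π + count≥ i (take (t * L) (map toℕ π))
      ≡⟨ cong (λ ys → countLow l (t * L) i π + count≥ i ys) (take-map (t * L) π) ⟩
    countLow l (t * L) i π + count≥ i (map toℕ (take (t * L) π))
      ≡⟨ count<+count≥ i (take (t * L) π) ⟩
    length (take (t * L) π)        ≡⟨ length-take-≤ (≤-trans (*-monoˡ-≤ L t≤n) (≤-reflexive (sym length-π))) ⟩
    t * L                          ≡⟨ cong (t *_) (sym (psum+inflow l i)) ⟩
    t * (psum l i + inflow l i)    ≡⟨ *-distribˡ-+ t (psum l i) _ ⟩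
    t * psum l i + t * inflow l i  ∎)
    where open ≡-Reasoning

  reach⇒countLow : ∀ {n} π → Reach l n (map toℕ π) → ∀ {t i} → t ≤ n → i < k →
                   countLow l (t * L) i π ≤ t * psum l i
  reach⇒countLow π R {t} {i} t≤n i<k =
    Equivalence.from (countLow⇔prefix π length-π i t≤n) (prefix≥ (reach⇒profile R i i<k) t≤n)
    where length-π = trans (sym (length-map toℕ π)) (reach-length R)

  countLow⇒reach : ∀ {n} π → (∀ i → count≥ i (map toℕ π) ≡ n * inflow l i) →
                   (∀ {t i} → 1 ≤ t → t ≤ n → 1 ≤ i → i < k → countLow l (t * L) i π ≤ t * psum l i) →
                   Reach l n (map toℕ π)
  countLow⇒reach {n} π balanced low = profile⇒reach n ys profile
    where
    ys = map toℕ π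
    length-ys : length ys ≡ n * L
    length-ys = trans (sym (count≥-zero ys)) (trans (balanced 0) (cong (n *_) (inflow-zero l)))
    length-π : length π ≡ n * L
    length-π = trans (sym (length-map toℕ π)) length-ys
    prefix : ∀ {i t} → i < k → t ≤ n → t * inflow l i ≤ count≥ i (take (t * L) ys)
    prefix {zero}  {t}     _   t≤n = ≤-reflexive (begin
      t * inflow l 0              ≡⟨ cong (t *_) (inflow-zero l) ⟩
      t * L                       ≡⟨ sym (length-take-≤ (≤-trans (*-monoˡ-≤ L t≤n) (≤-reflexive (sym length-ys)))) ⟩
      length (take (t * L) ys)    ≡⟨ sym (count≥-zero (take (t * L) ys)) ⟩
      count≥ 0 (take (t * L) ys)  ∎)
      where open ≡-Reasoning
    prefix {suc i} {zero}  _   _   = z≤n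
    prefix {suc i} {suc t} i<k t≤n =
      Equivalence.to (countLow⇔prefix π length-π (suc i) t≤n) (low (s≤s z≤n) t≤n (s≤s z≤n) i<k)
    profile : ∀ i → Profile n i ys
    profile i with k ≤? i
    ... | yes k≤i = profile-beyond k≤i (trans (balanced i) (*-inflow-beyond l n k≤i))
    ... | no  k≰i = record { total≡ = balanced i ; prefix≥ = prefix (≰⇒> k≰i) }

lemma3p1 : (k : ℕ) → 2 ≤ k → (n : ℕ) → 1 ≤ n →
    (l : Fin k → ℕ) → (∀ j → 1 ≤ l j) →
    (π : List (Fin k)) → (∀ j → countDir l j π ≡ n * l j) →
    (IsConfigPath l n π ⇔
      (∀ t i → 1 ≤ t → t ≤ n → 1 ≤ i → i ≤ k ∸ 1 →
        countLow l (t * total l) i π ≤ t * psum l i))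
lemma3p1 zero    ()
lemma3p1 (suc k) _ n _ l _ π dirs = mk⇔
  (λ reach t i _ t≤n _ i≤k → reach⇒countLow l π reach t≤n (s≤s i≤k))
  (λ low → countLow⇒reach l π (count≥-balanced l {n} π dirs)
             (λ {t} {i} 1≤t t≤n 1≤i i<1+k → low t i 1≤t t≤n 1≤i (s≤s⁻¹ i<1+k)))
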